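{- Let $k \geq 3$ be an integer and $n = 5k+4$. Let \[ S = \{1, 2, n-1, n-2\} \cup \{ x : 6 \leq x \leq 5(k-1)+3 \text{ and } x \equiv 1 \text{ or } 3 \pmod 5 \} \subseteq \mathbb{Z}_n. \] Then the Cayley graph $H(k) := \mathrm{Cay}(\mathbb{Z}_n, S)$ is a $(2k+2)$-regular $K_4$-saturated graph with $n$ vertices.
   Context: Elements of $\mathbb{Z}_n$ are identified with the residues $\{0,1,\dots,n-1\}$. The Cayley graph $\mathrm{Cay}(\mathbb{Z}_n,S)$ (for $S=-S$, $0\notin S$) has vertex set $\mathbb{Z}_n$, with $g,h$ adjacent iff $h-g \in S$. A graph $G$ is $K_4$-saturated if $G$ contains no $K_4$, but adding any edge between two nonadjacent vertices creates a $K_4$. A graph is $d$-regular if every vertex has degree $d$. -}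

module Defs where

open import Data.Nat using (ℕ; _+_; _*_; _∸_; _≤_; _<_)
open import Data.Nat.DivMod using (_%_)
open import Data.Fin using (Fin; toℕ)
open import Data.List using (List; length)
open import Data.List.Membership.Propositional using (_∈_)
open import Data.List.Relation.Unary.Unique.Propositional using (Unique)
open import Data.Product using (Σ; _×_; ∃)
open import Data.Sum using (_⊎_)
open import Relation.Binary.PropositionalEquality using (_≡_; _≢_)
open import Relation.Nullary using (¬_)
open import Function.Bundles using (_⇔_)

Graph : ℕ → Set₁
Graph n = Fin n → Fin n → Set

diffℤ : (n : ℕ) → Fin n → Fin n → ℕ
diffℤ n g h with toℕ g Data.Nat.≤? toℕ h
... | Relation.Nullary.yes _ = toℕ h ∸ toℕ g
... | Relation.Nullary.no  _ = (toℕ h + n) ∸ toℕ g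

Cay : (n : ℕ) → (ℕ → Set) → Graph n
Cay n S g h = S (diffℤ n g h)

SymmetricConn : ℕ → (ℕ → Set) → Set
SymmetricConn n S = (∀ x → x < n → S x → S (negℤ n x)) × ¬ S 0
  where
  negℤ : ℕ → ℕ → ℕ
  negℤ n 0 = 0
  negℤ n x@(Data.Nat.suc _) = n ∸ x

HasDegree : {n : ℕ} → Graph n → Fin n → ℕ → Set
HasDegree {n} G v d =
  Σ (List (Fin n)) λ L → Unique L × length L ≡ d × (∀ w → (G v w ⇔ w ∈ L))

Regular : {n : ℕ} → ℕ → Graph n → Set
Regular d G = ∀ v → HasDegree G v d

HasK4 : {n : ℕ} → Graph n → Set
HasK4 {n} G = Σ (Fin n) λ a → Σ (Fin n) λ b → Σ (Fin n) λ c → Σ (Fin n) λ d →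
  (a ≢ b × a ≢ c × a ≢ d × b ≢ c × b ≢ d × c ≢ d) ×
  (G a b × G a c × G a d × G b c × G b d × G c d)

addEdge : {n : ℕ} → Graph n → Fin n → Fin n → Graph n
addEdge G u v x y = G x y ⊎ ((x ≡ u × y ≡ v) ⊎ (x ≡ v × y ≡ u))

K4Saturated : {n : ℕ} → Graph n → Set
K4Saturated {n} G =
  ¬ HasK4 G × (∀ u v → u ≢ v → ¬ G u v → HasK4 (addEdge G u v))

nH : ℕ → ℕ
nH k = 5 * k + 4

SH : ℕ → ℕ → Set
SH k x = (x ≡ 1 ⊎ x ≡ 2 ⊎ x ≡ nH k ∸ 1 ⊎ x ≡ nH k ∸ 2)
       ⊎ (6 ≤ x × x ≤ 5 * (k ∸ 1) + 3 × (x % 5 ≡ 1 ⊎ x % 5 ≡ 3))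

H : (k : ℕ) → Graph (nH k)
H k = Cay (nH k) (SH k)

-- Write n = 5k + 4. Every element of S is ≡ 1, 2 or 3 (mod 5), and S is closed under
-- x ↦ n − x.
-- K₄-freeness: list the vertices of a K₄ as integers p < q < r < w in [0, n). By the
-- symmetry of S the gaps a = q − p, b = r − q, c = w − r satisfy a, b, c, a + b, b + c,
-- a + b + c ∈ S as integers below n. Residues mod 5 force a ≡ b ≡ c ≡ 1, hence
-- a + b, b + c ∈ {2, n − 2}, and each of the four cases puts 3 or n − 3 into S.
-- Saturation: for a non-edge uv with d = v − u, it suffices to find p, q ∈ S with
-- q − p, p − d, q − d ∈ S (mod n), for then u, v, u + p, u + q span a K₄ once uv is
-- added. Such p, q are exhibited for each residue class of d mod 5; this needs k ≥ 3.
-- Regularity: the neighbourhood of v is v + S, and S has 2k + 2 elements.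

module Submission where

open import Defs
open import Data.Nat
open import Data.Nat.Properties
open import Data.Nat.DivMod
open import Data.Nat.Tactic.RingSolver using (solve-∀)
open import Data.Product using (Σ; _×_; _,_; proj₂)
open import Data.Sum using (_⊎_; inj₁; inj₂)
open import Data.Empty using (⊥-elim)
open import Data.Fin using (Fin; toℕ; fromℕ<)
open import Data.Fin.Properties using (toℕ<n; toℕ-injective; toℕ-fromℕ<)
open import Data.List using (List; []; _∷_; map; length)
open import Data.List.Properties using (length-map)
open import Data.List.Membership.Propositional using (_∈_)
open import Data.List.Membership.Propositional.Properties using (∈-map⁺; ∈-map⁻)
open import Data.List.Relation.Unary.Any using (here; there)
open import Data.List.Relation.Unary.All as All using (All; []; _∷_)
import Data.List.Relation.Unary.All.Properties as All
open import Data.List.Relation.Unary.AllPairs as AllPairs using ([]; _∷_)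
open import Data.List.Relation.Unary.Linked using (Linked; [-]; _∷_)
open import Data.List.Relation.Unary.Linked.Properties using (Linked⇒AllPairs)
open import Data.List.Relation.Unary.Unique.Propositional using (Unique)
open import Function.Base using (_∘_; _∘′_)
open import Function.Bundles using (_⇔_; mk⇔; Equivalence)
open import Relation.Binary.PropositionalEquality
open import Relation.Binary.Definitions using (tri<; tri≈; tri>)
open import Relation.Nullary using (¬_; yes; no)

SumTriple : (ℕ → Set) → Set
SumTriple P = Σ ℕ λ a → Σ ℕ λ b → Σ ℕ λ c →
  P a × P b × P c × P (a + b) × P (b + c) × P (a + b + c)

SumTriple-map : ∀ {P Q : ℕ → Set} → (∀ {x} → P x → Q x) → SumTriple P → SumTriple Q
SumTriple-map f (a , b , c , Pa , Pb , Pc , Pab , Pbc , Pabc) =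
  a , b , c , f Pa , f Pb , f Pc , f Pab , f Pbc , f Pabc

module DifferenceGraph (P : ℕ → Set) where

  _~_ : ℕ → ℕ → Set
  u ~ v = (u < v × P (v ∸ u)) ⊎ (v < u × P (u ∸ v))

  ~-sym : ∀ {u v} → u ~ v → v ~ u
  ~-sym (inj₁ uv) = inj₂ uv
  ~-sym (inj₂ vu) = inj₁ vu

  ~-irrefl : ∀ {u} → ¬ u ~ u
  ~-irrefl (inj₁ (u<u , _)) = <-irrefl refl u<u
  ~-irrefl (inj₂ (u<u , _)) = <-irrefl refl u<u

  ~⇒P : ∀ {u v} → u < v → u ~ v → P (v ∸ u)
  ~⇒P _   (inj₁ (_ , Pvu)) = Pvu
  ~⇒P u<v (inj₂ (v<u , _)) = ⊥-elim (<-asym u<v v<u)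

  Clique4 : ℕ → ℕ → ℕ → ℕ → Set
  Clique4 p q r w = p ~ q × p ~ r × p ~ w × q ~ r × q ~ w × r ~ w

  private
    ∸-split : ∀ {p q r} → p ≤ q → q ≤ r → r ∸ p ≡ (q ∸ p) + (r ∸ q)
    ∸-split {p} {q} {r} p≤q q≤r = sym (begin
      (q ∸ p) + (r ∸ q)           ≡⟨ m+n∸m≡n p _ ⟨
      p + ((q ∸ p) + (r ∸ q)) ∸ p ≡⟨ cong (_∸ p) (+-assoc p (q ∸ p) (r ∸ q)) ⟨
      p + (q ∸ p) + (r ∸ q) ∸ p   ≡⟨ cong (λ z → z + (r ∸ q) ∸ p) (m+[n∸m]≡n p≤q) ⟩
      q + (r ∸ q) ∸ p             ≡⟨ cong (_∸ p) (m+[n∸m]≡n q≤r) ⟩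
      r ∸ p                       ∎)
      where open ≡-Reasoning

  sortedClique4⇒SumTriple : ∀ {p q r w} → p < q → q < r → r < w →
                            Clique4 p q r w → SumTriple P
  sortedClique4⇒SumTriple {p} {q} {r} {w} p<q q<r r<w (pq , pr , pw , qr , qw , rw) =
    q ∸ p , r ∸ q , w ∸ r , ~⇒P p<q pq , ~⇒P q<r qr , ~⇒P r<w rw ,
    subst P (∸-split p≤q q≤r) (~⇒P p<r pr) ,
    subst P (∸-split q≤r r≤w) (~⇒P q<w qw) ,
    subst P (trans (∸-split (<⇒≤ p<r) r≤w) (cong (_+ (w ∸ r)) (∸-split p≤q q≤r)))
            (~⇒P (<-trans p<r r<w) pw)
    where
    p≤q = <⇒≤ p<q
    q≤r = <⇒≤ q<r
    r≤w = <⇒≤ r<w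
    p<r = <-trans p<q q<r
    q<w = <-trans q<r r<w

  private
    sorted₃Clique4⇒SumTriple : ∀ {p q r w} → p < q → q < r → Clique4 p q r w → SumTriple P
    sorted₃Clique4⇒SumTriple {p} {q} {r} {w} p<q q<r k@(pq , pr , pw , qr , qw , rw) with <-cmp w p
    ... | tri< w<p _ _ =
      sortedClique4⇒SumTriple w<p p<q q<r (~-sym pw , ~-sym qw , ~-sym rw , pq , pr , qr)
    ... | tri≈ _ refl _ = ⊥-elim (~-irrefl pw)
    ... | tri> _ _ p<w with <-cmp w q
    ... | tri< w<q _ _ = sortedClique4⇒SumTriple p<w w<q q<r (pw , pq , pr , ~-sym qw , ~-sym rw , qr)
    ... | tri≈ _ refl _ = ⊥-elim (~-irrefl qw)
    ... | tri> _ _ q<w with <-cmp w r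
    ... | tri< w<r _ _ = sortedClique4⇒SumTriple p<q q<w w<r (pq , pw , pr , qw , qr , ~-sym rw)
    ... | tri≈ _ refl _ = ⊥-elim (~-irrefl rw)
    ... | tri> _ _ r<w = sortedClique4⇒SumTriple p<q q<r r<w k

    sorted₂Clique4⇒SumTriple : ∀ {p q r w} → p < q → Clique4 p q r w → SumTriple P
    sorted₂Clique4⇒SumTriple {p} {q} {r} {w} p<q k@(pq , pr , pw , qr , qw , rw) with <-cmp r p
    ... | tri< r<p _ _ = sorted₃Clique4⇒SumTriple r<p p<q (~-sym pr , ~-sym qr , rw , pq , pw , qw)
    ... | tri≈ _ refl _ = ⊥-elim (~-irrefl pr)
    ... | tri> _ _ p<r with <-cmp r q
    ... | tri< r<q _ _ = sorted₃Clique4⇒SumTriple p<r r<q (pr , pq , pw , ~-sym qr , rw , qw)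
    ... | tri≈ _ refl _ = ⊥-elim (~-irrefl qr)
    ... | tri> _ _ q<r = sorted₃Clique4⇒SumTriple p<q q<r k

  clique4⇒SumTriple : ∀ {p q r w} → Clique4 p q r w → SumTriple P
  clique4⇒SumTriple {p} {q} k@(pq , pr , pw , qr , qw , rw) with <-cmp p q
  ... | tri< p<q _ _ = sorted₂Clique4⇒SumTriple p<q k
  ... | tri≈ _ refl _ = ⊥-elim (~-irrefl pq)
  ... | tri> _ _ q<p = sorted₂Clique4⇒SumTriple q<p (~-sym pq , qr , qw , pr , pw , rw)

module ℤ-mod (n : ℕ) {{_ : NonZero n}} where

  diff-≤ : ∀ {x y} → toℕ x ≤ toℕ y → diffℤ n x y ≡ toℕ y ∸ toℕ x
  diff-≤ {x} {y} x≤y with toℕ x ≤? toℕ y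
  ... | yes _   = refl
  ... | no  x≰y = ⊥-elim (x≰y x≤y)

  diff-> : ∀ {x y} → toℕ y < toℕ x → diffℤ n x y ≡ toℕ y + n ∸ toℕ x
  diff-> {x} {y} y<x with toℕ x ≤? toℕ y
  ... | yes x≤y = ⊥-elim (<⇒≱ y<x x≤y)
  ... | no  _   = refl

  diff->-n∸ : ∀ {x y} → toℕ y < toℕ x → diffℤ n x y ≡ n ∸ (toℕ x ∸ toℕ y)
  diff->-n∸ {x} {y} y<x = begin
    diffℤ n x y                             ≡⟨ diff-> y<x ⟩
    toℕ y + n ∸ toℕ x       ≡⟨ cong (toℕ y + n ∸_) (m+[n∸m]≡n (<⇒≤ y<x)) ⟨
    toℕ y + n ∸ (toℕ y + δ) ≡⟨ [m+n]∸[m+o]≡n∸o (toℕ y) n δ ⟩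
    n ∸ δ                   ∎
    where
    open ≡-Reasoning
    δ = toℕ x ∸ toℕ y

  diff-self : ∀ x → diffℤ n x x ≡ 0
  diff-self x = trans (diff-≤ {x} {x} ≤-refl) (n∸n≡0 (toℕ x))

  private
    x≤y+n : ∀ (x y : Fin n) → toℕ x ≤ toℕ y + n
    x≤y+n x y = ≤-trans (<⇒≤ (toℕ<n x)) (m≤n+m n (toℕ y))

  diff-< : ∀ x y → diffℤ n x y < n
  diff-< x y with toℕ x ≤? toℕ y
  ... | yes _   = ≤-<-trans (m∸n≤m (toℕ y) (toℕ x)) (toℕ<n y)
  ... | no  x≰y = +-cancelʳ-< (toℕ x) _ n (begin-strict
    toℕ y + n ∸ toℕ x + toℕ x ≡⟨ m∸n+n≡m (x≤y+n x y) ⟩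
    toℕ y + n                 <⟨ +-monoˡ-< n (≰⇒> x≰y) ⟩
    toℕ x + n                 ≡⟨ +-comm (toℕ x) n ⟩
    n + toℕ x                 ∎)
    where open ≤-Reasoning

  +-diff : ∀ x y → (toℕ x + diffℤ n x y) % n ≡ toℕ y
  +-diff x y with toℕ x ≤? toℕ y
  ... | yes x≤y = trans (cong (_% n) (m+[n∸m]≡n x≤y)) (m<n⇒m%n≡m (toℕ<n y))
  ... | no  _   = begin
    (toℕ x + (toℕ y + n ∸ toℕ x)) % n ≡⟨ cong (_% n) (m+[n∸m]≡n (x≤y+n x y)) ⟩
    (toℕ y + n) % n                   ≡⟨ [m+n]%n≡m%n (toℕ y) n ⟩
    toℕ y % n                         ≡⟨ m<n⇒m%n≡m (toℕ<n y) ⟩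
    toℕ y                             ∎
    where open ≡-Reasoning

  ≢⇒diff>0 : ∀ {x y} → x ≢ y → 0 < diffℤ n x y
  ≢⇒diff>0 {x} {y} x≢y = n≢0⇒n>0 λ diff≡0 → x≢y (toℕ-injective (begin
    toℕ x                       ≡⟨ m<n⇒m%n≡m (toℕ<n x) ⟨
    toℕ x % n                   ≡⟨ cong (_% n) (+-identityʳ (toℕ x)) ⟨
    (toℕ x + 0) % n             ≡⟨ cong (λ z → (toℕ x + z) % n) diff≡0 ⟨
    (toℕ x + diffℤ n x y) % n   ≡⟨ +-diff x y ⟩
    toℕ y                       ∎))
    where open ≡-Reasoning

  _+ₙ_ : Fin n → ℕ → Fin n
  x +ₙ s = fromℕ< (m%n<n (toℕ x + s) n)

  toℕ-+ₙ : ∀ x s → toℕ (x +ₙ s) ≡ (toℕ x + s) % n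
  toℕ-+ₙ x s = toℕ-fromℕ< (m%n<n (toℕ x + s) n)

  +ₙ-diff : ∀ x y → x +ₙ diffℤ n x y ≡ y
  +ₙ-diff x y = toℕ-injective (trans (toℕ-+ₙ x (diffℤ n x y)) (+-diff x y))

  private
    toℕ-+ₙ-wraps : ∀ x s → s < n → n ≤ toℕ x + s → toℕ (x +ₙ s) + n ≡ toℕ x + s
    toℕ-+ₙ-wraps x s s<n n≤x+s = begin
      toℕ (x +ₙ s) + n      ≡⟨ cong (_+ n) (toℕ-+ₙ x s) ⟩
      (toℕ x + s) % n + n   ≡⟨ cong (λ z → z % n + n) (m∸n+n≡m n≤x+s) ⟨
      (r + n) % n + n       ≡⟨ cong (_+ n) ([m+n]%n≡m%n r n) ⟩
      r % n + n             ≡⟨ cong (_+ n) (m<n⇒m%n≡m r<n) ⟩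
      r + n                 ≡⟨ m∸n+n≡m n≤x+s ⟩
      toℕ x + s             ∎
      where
      open ≡-Reasoning
      r = toℕ x + s ∸ n
      r<n : r < n
      r<n = m<n+o⇒m∸n<o (toℕ x + s) n (+-mono-< (toℕ<n x) s<n)

  diff-+ₙ : ∀ x s → s < n → diffℤ n x (x +ₙ s) ≡ s
  diff-+ₙ x s s<n with toℕ x + s <? n
  ... | yes x+s<n = begin
    diffℤ n x (x +ₙ s)       ≡⟨ diff-≤ (subst (toℕ x ≤_) (sym y≡x+s) (m≤m+n (toℕ x) s)) ⟩
    toℕ (x +ₙ s) ∸ toℕ x     ≡⟨ cong (_∸ toℕ x) y≡x+s ⟩
    toℕ x + s ∸ toℕ x        ≡⟨ m+n∸m≡n (toℕ x) s ⟩
    s                        ∎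
    where
    open ≡-Reasoning
    y≡x+s : toℕ (x +ₙ s) ≡ toℕ x + s
    y≡x+s = trans (toℕ-+ₙ x s) (m<n⇒m%n≡m x+s<n)
  ... | no x+s≮n = begin
    diffℤ n x (x +ₙ s)       ≡⟨ diff-> y<x ⟩
    toℕ (x +ₙ s) + n ∸ toℕ x ≡⟨ cong (_∸ toℕ x) y+n≡x+s ⟩
    toℕ x + s ∸ toℕ x        ≡⟨ m+n∸m≡n (toℕ x) s ⟩
    s                        ∎
    where
    open ≡-Reasoning
    y+n≡x+s = toℕ-+ₙ-wraps x s s<n (≮⇒≥ x+s≮n)
    y<x : toℕ (x +ₙ s) < toℕ x
    y<x = +-cancelʳ-< n _ (toℕ x) (subst (_< toℕ x + n) (sym y+n≡x+s) (+-monoʳ-< (toℕ x) s<n))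

  +ₙ-injective : ∀ x {s t} → s < n → t < n → x +ₙ s ≡ x +ₙ t → s ≡ t
  +ₙ-injective x {s} {t} s<n t<n eq = begin
    s                  ≡⟨ diff-+ₙ x s s<n ⟨
    diffℤ n x (x +ₙ s) ≡⟨ cong (diffℤ n x) eq ⟩
    diffℤ n x (x +ₙ t) ≡⟨ diff-+ₙ x t t<n ⟩
    t                  ∎
    where open ≡-Reasoning

  map-+ₙ-unique : ∀ x {L} → All (_< n) L → Unique L → Unique (map (x +ₙ_) L)
  map-+ₙ-unique x []            []          = []
  map-+ₙ-unique x (s<n ∷ L<n) (s∉L ∷ L!) =
    All.map⁺ (All.zipWith (λ (s≢t , t<n) → s≢t ∘ +ₙ-injective x s<n t<n) (s∉L , L<n)) ∷
    map-+ₙ-unique x L<n L!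

  -- Congruence modulo n, adequate for s, w < n since their sum wraps around at most once.
  _+_≡_mod : ℕ → ℕ → ℕ → Set
  s + w ≡ t mod = s + w ≡ t ⊎ s + w ≡ t + n

  +ₙ-+ₙ : ∀ x {s w t} → s + w ≡ t mod → (x +ₙ s) +ₙ w ≡ x +ₙ t
  +ₙ-+ₙ x {s} {w} {t} s+w≡t = toℕ-injective (begin
    toℕ ((x +ₙ s) +ₙ w)               ≡⟨ toℕ-+ₙ (x +ₙ s) w ⟩
    (toℕ (x +ₙ s) + w) % n            ≡⟨ cong (λ z → (z + w) % n) (toℕ-+ₙ x s) ⟩
    ((toℕ x + s) % n + w) % n         ≡⟨ %-distribˡ-+ ((toℕ x + s) % n) w n ⟩
    ((toℕ x + s) % n % n + w % n) % n ≡⟨ cong (λ z → (z + w % n) % n) (m%n%n≡m%n _ n) ⟩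
    ((toℕ x + s) % n + w % n) % n     ≡⟨ %-distribˡ-+ (toℕ x + s) w n ⟨
    (toℕ x + s + w) % n               ≡⟨ cong (_% n) (+-assoc (toℕ x) s w) ⟩
    (toℕ x + (s + w)) % n             ≡⟨ reduce s+w≡t ⟩
    (toℕ x + t) % n                   ≡⟨ toℕ-+ₙ x t ⟨
    toℕ (x +ₙ t)                      ∎)
    where
    open ≡-Reasoning
    reduce : s + w ≡ t mod → (toℕ x + (s + w)) % n ≡ (toℕ x + t) % n
    reduce (inj₁ eq) = cong (λ z → (toℕ x + z) % n) eq
    reduce (inj₂ eq) = begin
      (toℕ x + (s + w)) % n ≡⟨ cong (λ z → (toℕ x + z) % n) eq ⟩
      (toℕ x + (t + n)) % n ≡⟨ cong (_% n) (+-assoc (toℕ x) t n) ⟨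
      (toℕ x + t + n) % n   ≡⟨ [m+n]%n≡m%n (toℕ x + t) n ⟩
      (toℕ x + t) % n       ∎

  data CommonNeighbourEdge (S : ℕ → Set) (d : ℕ) : Set where
    common-edge : ∀ {p q p→q d→p d→q} → S p → S q → S p→q → S d→p → S d→q →
                  p + p→q ≡ q mod → d + d→p ≡ p mod → d + d→q ≡ q mod →
                  CommonNeighbourEdge S d

  CommonNeighbourEdge-map : ∀ {S T : ℕ → Set} {d} → (∀ {x} → S x → T x) →
                            CommonNeighbourEdge S d → CommonNeighbourEdge T d
  CommonNeighbourEdge-map f (common-edge Sp Sq Sp→q Sd→p Sd→q p+ d+p d+q) =
    common-edge (f Sp) (f Sq) (f Sp→q) (f Sd→p) (f Sd→q) p+ d+p d+q

  module _ (S : ℕ → Set) where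
    open DifferenceGraph S

    Cay-+ₙ : ∀ x {s} → s < n → S s → Cay n S x (x +ₙ s)
    Cay-+ₙ x {s} s<n = subst S (sym (diff-+ₙ x s s<n))

    SymmetricConn⇒∸-closed : SymmetricConn n S →
                             ∀ {x} → 0 < x → x < n → S x → S (n ∸ x)
    SymmetricConn⇒∸-closed (S-sym , _) {suc x} _ = S-sym (suc x)

    Cay⇒≢ : SymmetricConn n S → ∀ {x y} → Cay n S x y → x ≢ y
    Cay⇒≢ (_ , ¬S0) {x} Sxy refl = ¬S0 (subst S (diff-self x) Sxy)

    Cay-descending : SymmetricConn n S → ∀ {x y} → toℕ y < toℕ x →
                     Cay n S x y → S (toℕ x ∸ toℕ y)
    Cay-descending conn {x} {y} y<x Sxy =
      subst S (m∸[m∸n]≡n δ≤n) (SymmetricConn⇒∸-closed conn (m<n⇒0<n∸m δ<n) n∸δ<n S[n∸δ])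
      where
      δ<n : toℕ x ∸ toℕ y < n
      δ<n = ≤-<-trans (m∸n≤m (toℕ x) (toℕ y)) (toℕ<n x)
      δ≤n = <⇒≤ δ<n
      n∸δ<n = ∸-monoʳ-< (m<n⇒0<n∸m y<x) δ≤n
      S[n∸δ] = subst S (diff->-n∸ y<x) Sxy

    Cay⇒~ : SymmetricConn n S → ∀ x y → Cay n S x y → toℕ x ~ toℕ y
    Cay⇒~ conn x y Sxy with <-cmp (toℕ x) (toℕ y)
    ... | tri< x<y _ _ = inj₁ (x<y , subst S (diff-≤ (<⇒≤ x<y)) Sxy)
    ... | tri≈ _ x≡y _ = ⊥-elim (Cay⇒≢ conn Sxy (toℕ-injective x≡y))
    ... | tri> _ _ y<x = inj₂ (y<x , Cay-descending conn y<x Sxy)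

    Cay-K4⇒SumTriple : SymmetricConn n S → HasK4 (Cay n S) → SumTriple S
    Cay-K4⇒SumTriple conn (a , b , c , d , _ , (ab , ac , ad , bc , bd , cd)) =
      clique4⇒SumTriple (~ a b ab , ~ a c ac , ~ a d ad , ~ b c bc , ~ b d bd , ~ c d cd)
      where ~ = Cay⇒~ conn

    addEdge-K4 : SymmetricConn n S → (∀ {x} → S x → x < n) → ∀ u v → u ≢ v →
                 CommonNeighbourEdge S (diffℤ n u v) → HasK4 (addEdge (Cay n S) u v)
    addEdge-K4 conn S<n u v u≢v
               (common-edge {p} {q} {p→q} {d→p} {d→q} Sp Sq Sp→q Sd→p Sd→q p+p→q d+d→p d+d→q) =
      u , v , x , y , (u≢v , ≢ ux , ≢ uy , ≢ vx , ≢ vy , ≢ xy) ,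
      (inj₂ (inj₁ (refl , refl)) , inj₁ ux , inj₁ uy , inj₁ vx , inj₁ vy , inj₁ xy)
      where
      ≢ : ∀ {a b} → Cay n S a b → a ≢ b
      ≢ = Cay⇒≢ conn
      x = u +ₙ p
      y = u +ₙ q
      v≡u+d : v ≡ u +ₙ diffℤ n u v
      v≡u+d = sym (+ₙ-diff u v)
      ux : Cay n S u x
      ux = Cay-+ₙ u (S<n Sp) Sp
      uy : Cay n S u y
      uy = Cay-+ₙ u (S<n Sq) Sq
      vx : Cay n S v x
      vx = subst (Cay n S v) (trans (cong (_+ₙ d→p) v≡u+d) (+ₙ-+ₙ u d+d→p))
                 (Cay-+ₙ v (S<n Sd→p) Sd→p)
      vy : Cay n S v y
      vy = subst (Cay n S v) (trans (cong (_+ₙ d→q) v≡u+d) (+ₙ-+ₙ u d+d→q))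
                 (Cay-+ₙ v (S<n Sd→q) Sd→q)
      xy : Cay n S x y
      xy = subst (Cay n S x) (+ₙ-+ₙ u p+p→q) (Cay-+ₙ x (S<n Sp→q) Sp→q)

    Cay-regular : (∀ {x} → S x → x < n) →
                  ∀ {L} → Unique L → (∀ {x} → S x ⇔ x ∈ L) → Regular (length L) (Cay n S)
    Cay-regular S<n {L} L! S⇔L v =
      map (v +ₙ_) L , map-+ₙ-unique v (All.tabulate (S<n ∘ from)) L! , length-map (v +ₙ_) L ,
      λ w → mk⇔ (Cay⇒∈ w) (∈⇒Cay w)
      where
      open module Enumeration {x} = Equivalence (S⇔L {x}) using (to; from)
      Cay⇒∈ : ∀ w → Cay n S v w → w ∈ map (v +ₙ_) L
      Cay⇒∈ w Svw = subst (_∈ map (v +ₙ_) L) (+ₙ-diff v w) (∈-map⁺ (v +ₙ_) (to Svw))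
      ∈⇒Cay : ∀ w → w ∈ map (v +ₙ_) L → Cay n S v w
      ∈⇒Cay w w∈ with s , s∈L , refl ← ∈-map⁻ (v +ₙ_) w∈ =
        Cay-+ₙ v (S<n (from s∈L)) (from s∈L)

-- S in normal form: {1 + 5q ∣ q < k} ∪ {3 + 5q ∣ 1 ≤ q ≤ k} ∪ {2, n − 2}; note n − 1 = 3 + 5k.
data Conn (k : ℕ) : ℕ → Set where
  one+5q   : ∀ q → q < k → Conn k (1 + 5 * q)
  three+5q : ∀ q → 0 < q → q ≤ k → Conn k (3 + 5 * q)
  two      : Conn k 2
  two+5k   : Conn k (2 + 5 * k)

[r+5q]%5≡r%5 : ∀ r q → (r + 5 * q) % 5 ≡ r % 5
[r+5q]%5≡r%5 r q = trans (cong (λ z → (r + z) % 5) (*-comm 5 q)) ([m+kn]%n≡m%n r q 5)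

x≡r+5[x/5] : ∀ x {r} → x % 5 ≡ r → x ≡ r + 5 * (x / 5)
x≡r+5[x/5] x x%5≡r = trans (m≡m%n+[m/n]*n x 5) (cong₂ _+_ x%5≡r (*-comm (x / 5) 5))

[r+5q]%5≢ : ∀ r q {s} → r % 5 ≢ s → (r + 5 * q) % 5 ≢ s
[r+5q]%5≢ r q r≢s eq = r≢s (trans (sym ([r+5q]%5≡r%5 r q)) eq)

r+5q≢s+5t : ∀ r q s t → r % 5 ≢ s % 5 → r + 5 * q ≢ s + 5 * t
r+5q≢s+5t r q s t r≢s eq = [r+5q]%5≢ r q r≢s (trans (cong (_% 5) eq) ([r+5q]%5≡r%5 s t))

r+5q≡r+5t⇒q≡t : ∀ r {q t} → r + 5 * q ≡ r + 5 * t → q ≡ t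
r+5q≡r+5t⇒q≡t r {q} {t} eq = *-cancelˡ-≡ q t 5 (+-cancelˡ-≡ r _ _ eq)

r+5q≤4+5k⇒q≤k : ∀ r {q k} → r + 5 * q ≤ 4 + 5 * k → q ≤ k
r+5q≤4+5k⇒q≤k r {q} {k} le with q ≤? k
... | yes q≤k = q≤k
... | no  q≰k = ⊥-elim (<-irrefl refl (begin-strict
  4 + 5 * k     <⟨ +-monoˡ-< (5 * k) (n<1+n 4) ⟩
  5 + 5 * k     ≡⟨ *-suc 5 k ⟨
  5 * suc k     ≤⟨ *-monoʳ-≤ 5 (≰⇒> q≰k) ⟩
  5 * q         ≤⟨ m≤n+m (5 * q) r ⟩
  r + 5 * q     ≤⟨ le ⟩
  4 + 5 * k     ∎))
  where open ≤-Reasoning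

Conn-pos : ∀ {k x} → Conn k x → 0 < x
Conn-pos (one+5q _ _)     = z<s
Conn-pos (three+5q _ _ _) = z<s
Conn-pos two              = z<s
Conn-pos two+5k           = z<s

Conn-< : ∀ {k x} → Conn k x → x < 4 + 5 * k
Conn-< (one+5q q q<k)     = +-mono-≤ {2} {4} (s≤s (s≤s z≤n)) (*-monoʳ-≤ 5 (<⇒≤ q<k))
Conn-< (three+5q _ _ q≤k) = +-monoʳ-≤ 4 (*-monoʳ-≤ 5 q≤k)
Conn-< two                = s≤s (s≤s (s≤s z≤n))
Conn-< two+5k             = s≤s (s≤s (s≤s (n≤1+n _)))

¬Conn[3] : ∀ {k} → ¬ Conn k 3
¬Conn[3] {k} c = x≢3 c refl
  where
  x≢3 : ∀ {x} → Conn k x → x ≢ 3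
  x≢3 (one+5q q _)           eq = r+5q≢s+5t 1 q 3 0 (λ ()) eq
  x≢3 (three+5q (suc q) _ _) ()
  x≢3 two                    ()
  x≢3 two+5k                 eq = r+5q≢s+5t 2 k 3 0 (λ ()) eq

¬Conn[1+5k] : ∀ {k} → ¬ Conn k (1 + 5 * k)
¬Conn[1+5k] {k} c = x≢1+5k c refl
  where
  x≢1+5k : ∀ {x} → Conn k x → x ≢ 1 + 5 * k
  x≢1+5k (one+5q q q<k)   eq = <-irrefl (r+5q≡r+5t⇒q≡t 1 eq) q<k
  x≢1+5k (three+5q q _ _) eq = r+5q≢s+5t 3 q 1 k (λ ()) eq
  x≢1+5k two              eq = r+5q≢s+5t 2 0 1 k (λ ()) eq
  x≢1+5k two+5k           eq = r+5q≢s+5t 2 k 1 k (λ ()) eq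

Conn-2mod5 : ∀ {k x} → Conn k x → x % 5 ≡ 2 → x ≡ 2 ⊎ x ≡ 2 + 5 * k
Conn-2mod5 (one+5q q _) eq     = ⊥-elim ([r+5q]%5≢ 1 q (λ ()) eq)
Conn-2mod5 (three+5q q _ _) eq = ⊥-elim ([r+5q]%5≢ 3 q (λ ()) eq)
Conn-2mod5 two              _  = inj₁ refl
Conn-2mod5 two+5k           _  = inj₂ refl

data Res₁₂₃ : ℕ → Set where
  r₁ : Res₁₂₃ 1
  r₂ : Res₁₂₃ 2
  r₃ : Res₁₂₃ 3

Conn-mod5 : ∀ {k x} → Conn k x → Res₁₂₃ (x % 5)
Conn-mod5 (one+5q q _)     = subst Res₁₂₃ (sym ([r+5q]%5≡r%5 1 q)) r₁
Conn-mod5 (three+5q q _ _) = subst Res₁₂₃ (sym ([r+5q]%5≡r%5 3 q)) r₃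
Conn-mod5 two              = r₂
Conn-mod5 {k} two+5k       = subst Res₁₂₃ (sym ([r+5q]%5≡r%5 2 k)) r₂

sumTriple-mod5 : ∀ {x y z} → Res₁₂₃ x → Res₁₂₃ y → Res₁₂₃ z →
  Res₁₂₃ ((x + y) % 5) → Res₁₂₃ ((y + z) % 5) → Res₁₂₃ (((x + y) % 5 + z) % 5) →
  x ≡ 1 × y ≡ 1 × z ≡ 1
sumTriple-mod5 r₁ r₁ r₁ _  _  _  = refl , refl , refl
sumTriple-mod5 r₁ r₁ r₂ _  _  ()
sumTriple-mod5 r₁ r₁ r₃ _  () _
sumTriple-mod5 r₁ r₂ r₁ _  _  ()
sumTriple-mod5 r₁ r₂ r₂ _  () _
sumTriple-mod5 r₁ r₂ r₃ _  () _
sumTriple-mod5 r₁ r₃ _  () _  _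
sumTriple-mod5 r₂ r₁ r₁ _  _  ()
sumTriple-mod5 r₂ r₁ r₂ _  _  ()
sumTriple-mod5 r₂ r₁ r₃ _  () _
sumTriple-mod5 r₂ r₂ _  () _  _
sumTriple-mod5 r₂ r₃ _  () _  _
sumTriple-mod5 r₃ r₁ _  () _  _
sumTriple-mod5 r₃ r₂ _  () _  _
sumTriple-mod5 r₃ r₃ r₁ _  () _
sumTriple-mod5 r₃ r₃ r₂ _  () _
sumTriple-mod5 r₃ r₃ r₃ _  _  ()

private
  x+y≡2 : ∀ {x y} → 0 < x → 0 < y → x + y ≡ 2 → x ≡ 1 × y ≡ 1
  x+y≡2 {1}           {1}           _ _ _  = refl , refl
  x+y≡2 {1}           {suc (suc _)} _ _ ()
  x+y≡2 {suc (suc x)} {suc y}       _ _ eq =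
    ⊥-elim (1+n≢0 (trans (sym (+-suc x y)) (suc-injective (suc-injective eq))))

  x+1≡2+5k : ∀ {x k} → x + 1 ≡ 2 + 5 * k → x ≡ 1 + 5 * k
  x+1≡2+5k {x} eq = suc-injective (trans (+-comm 1 x) eq)

  2+5k+c<4+5k⇒c≤1 : ∀ {k c} → 2 + 5 * k + c < 4 + 5 * k → c ≤ 1
  2+5k+c<4+5k⇒c≤1 {k} {c} lt =
    s≤s⁻¹ (+-cancelˡ-< (2 + 5 * k) c 2 (subst (2 + 5 * k + c <_) (+-comm 2 (2 + 5 * k)) lt))

sumTriple-shape : ∀ {k a b c} → 0 < a → 0 < b → 0 < c → a + b + c < 4 + 5 * k →
  (a + b ≡ 2 ⊎ a + b ≡ 2 + 5 * k) → (b + c ≡ 2 ⊎ b + c ≡ 2 + 5 * k) →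
  a + b + c ≡ 3 ⊎ a ≡ 1 + 5 * k ⊎ b ≡ 1 + 5 * k ⊎ c ≡ 1 + 5 * k
sumTriple-shape a>0 b>0 c>0 _ (inj₁ ab≡2) (inj₁ bc≡2)
  with refl , refl ← x+y≡2 a>0 b>0 ab≡2 | refl ← proj₂ (x+y≡2 b>0 c>0 bc≡2) = inj₁ refl
sumTriple-shape a>0 b>0 _ _ (inj₁ ab≡2) (inj₂ bc≡n∸2)
  with refl ← proj₂ (x+y≡2 a>0 b>0 ab≡2) = inj₂ (inj₂ (inj₂ (suc-injective bc≡n∸2)))
sumTriple-shape {k} {a} _ b>0 c>0 _ (inj₂ ab≡n∸2) (inj₁ bc≡2)
  with refl , refl ← x+y≡2 b>0 c>0 bc≡2 = inj₂ (inj₁ (x+1≡2+5k {a} {k} ab≡n∸2))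
sumTriple-shape {k} {a} {b} {c} _ _ c>0 abc<n (inj₂ ab≡n∸2) (inj₂ bc≡n∸2)
  with refl ← ≤-antisym (2+5k+c<4+5k⇒c≤1 {k} (subst (λ z → z + c < 4 + 5 * k) ab≡n∸2 abc<n))
                        c>0
  = inj₂ (inj₂ (inj₁ (x+1≡2+5k {b} {k} bc≡n∸2)))

private
  [x+y+z]%5 : ∀ x y z → (x + y + z) % 5 ≡ ((x % 5 + y % 5) % 5 + z % 5) % 5
  [x+y+z]%5 x y z =
    trans (%-distribˡ-+ (x + y) z 5) (cong (λ w → (w + z % 5) % 5) (%-distribˡ-+ x y 5))

  x+y≡2mod5 : ∀ x y → x % 5 ≡ 1 → y % 5 ≡ 1 → (x + y) % 5 ≡ 2
  x+y≡2mod5 x y x≡1 y≡1 =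
    trans (%-distribˡ-+ x y 5) (cong₂ (λ u v → (u + v) % 5) x≡1 y≡1)

Conn-noSumTriple : ∀ {k} → ¬ SumTriple (Conn k)
Conn-noSumTriple {k} (a , b , c , A , B , C , AB , BC , ABC)
  with a≡1 , b≡1 , c≡1 ← sumTriple-mod5 (Conn-mod5 A) (Conn-mod5 B) (Conn-mod5 C)
         (subst Res₁₂₃ (%-distribˡ-+ a b 5) (Conn-mod5 AB))
         (subst Res₁₂₃ (%-distribˡ-+ b c 5) (Conn-mod5 BC))
         (subst Res₁₂₃ ([x+y+z]%5 a b c) (Conn-mod5 ABC))
  with sumTriple-shape {k} (Conn-pos A) (Conn-pos B) (Conn-pos C) (Conn-< ABC)
         (Conn-2mod5 AB (x+y≡2mod5 a b a≡1 b≡1)) (Conn-2mod5 BC (x+y≡2mod5 b c b≡1 c≡1))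
... | inj₁ abc≡3               = ¬Conn[3] (subst (Conn k) abc≡3 ABC)
... | inj₂ (inj₁ a≡1+5k)       = ¬Conn[1+5k] (subst (Conn k) a≡1+5k A)
... | inj₂ (inj₂ (inj₁ b≡1+5k)) = ¬Conn[1+5k] (subst (Conn k) b≡1+5k B)
... | inj₂ (inj₂ (inj₂ c≡1+5k)) = ¬Conn[1+5k] (subst (Conn k) c≡1+5k C)

nH∸1 : ∀ k → nH k ∸ 1 ≡ 3 + 5 * k
nH∸1 k = trans (+-∸-assoc (5 * k) {4} {1} z<s) (+-comm (5 * k) 3)

nH∸2 : ∀ k → nH k ∸ 2 ≡ 2 + 5 * k
nH∸2 k = trans (+-∸-assoc (5 * k) {4} {2} (s≤s z<s)) (+-comm (5 * k) 2)

private
  r+5q≤5m+3 : ∀ {r q m} → r ≤ 3 → q ≤ m → r + 5 * q ≤ 5 * m + 3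
  r+5q≤5m+3 {r} {q} {m} r≤3 q≤m =
    ≤-trans (+-mono-≤ r≤3 (*-monoʳ-≤ 5 q≤m)) (≤-reflexive (+-comm 3 (5 * m)))

  quotient≤ : ∀ r {x q m} → x ≡ r + 5 * q → x ≤ 5 * m + 3 → q ≤ m
  quotient≤ r {m = m} refl x≤5m+3 =
    r+5q≤4+5k⇒q≤k r (≤-trans x≤5m+3 (≤-trans (≤-reflexive (+-comm (5 * m) 3)) (n≤1+n _)))

SH⇒Conn : ∀ {m x} → SH (suc m) x → Conn (suc m) x
SH⇒Conn (inj₁ (inj₁ refl))                = one+5q 0 z<s
SH⇒Conn (inj₁ (inj₂ (inj₁ refl)))         = two
SH⇒Conn {m} (inj₁ (inj₂ (inj₂ (inj₁ eq)))) =
  subst (Conn (suc m)) (sym (trans eq (nH∸1 (suc m)))) (three+5q (suc m) z<s ≤-refl)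
SH⇒Conn {m} (inj₁ (inj₂ (inj₂ (inj₂ eq)))) =
  subst (Conn (suc m)) (sym (trans eq (nH∸2 (suc m)))) two+5k
SH⇒Conn {m} {x} (inj₂ (_ , x≤5m+3 , inj₁ x%5≡1)) =
  subst (Conn (suc m)) (sym x≡) (one+5q (x / 5) (s≤s (quotient≤ 1 x≡ x≤5m+3)))
  where x≡ = x≡r+5[x/5] x x%5≡1
SH⇒Conn {m} {x} (inj₂ (6≤x , x≤5m+3 , inj₂ x%5≡3)) with x / 5 | x≡r+5[x/5] x x%5≡3
... | zero  | refl = ⊥-elim (<⇒≱ 6≤x (s≤s (s≤s (s≤s z≤n))))
... | suc q | x≡   =
  subst (Conn (suc m)) (sym x≡) (three+5q (suc q) z<s (m≤n⇒m≤1+n (quotient≤ 3 x≡ x≤5m+3)))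

Conn⇒SH : ∀ {m x} → Conn (suc m) x → SH (suc m) x
Conn⇒SH (one+5q zero _)             = inj₁ (inj₁ refl)
Conn⇒SH (one+5q (suc q) (s≤s q<m))  =
  inj₂ (s≤s (*-monoʳ-≤ 5 z<s) , r+5q≤5m+3 z<s q<m , inj₁ ([r+5q]%5≡r%5 1 (suc q)))
Conn⇒SH {m} (three+5q q 0<q q≤1+m) with m≤n⇒m<n∨m≡n q≤1+m
... | inj₁ (s≤s q≤m) =
  inj₂ (≤-trans (m≤n+m 6 2) (+-monoʳ-≤ 3 (*-monoʳ-≤ 5 0<q)) , r+5q≤5m+3 ≤-refl q≤m ,
        inj₂ ([r+5q]%5≡r%5 3 q))
... | inj₂ refl      = inj₁ (inj₂ (inj₂ (inj₁ (sym (nH∸1 (suc m))))))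
Conn⇒SH two                         = inj₁ (inj₂ (inj₁ refl))
Conn⇒SH {m} two+5k                  = inj₁ (inj₂ (inj₂ (inj₂ (sym (nH∸2 (suc m))))))

Conn-complement : ∀ {k x} → Conn k x → Σ ℕ λ y → Conn k y × x + y ≡ 4 + 5 * k
Conn-complement (one+5q q q<k) with t , refl ← m≤n⇒∃[o]m+o≡n q<k =
  3 + 5 * suc t , three+5q (suc t) z<s (s≤s (m≤n+m t q)) , eq q t
  where
  eq : ∀ q t → 1 + 5 * q + (3 + 5 * suc t) ≡ 4 + 5 * suc (q + t)
  eq = solve-∀
Conn-complement (three+5q (suc q) _ q≤k) with t , refl ← m≤n⇒∃[o]m+o≡n q≤k =
  1 + 5 * t , one+5q t (s≤s (m≤n+m t q)) , eq q t
  where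
  eq : ∀ q t → 3 + 5 * suc q + (1 + 5 * t) ≡ 4 + 5 * (suc q + t)
  eq = solve-∀
Conn-complement {k} two    = 2 + 5 * k , two+5k , refl
Conn-complement {k} two+5k = 2 , two , eq k
  where
  eq : ∀ k → 2 + 5 * k + 2 ≡ 4 + 5 * k
  eq = solve-∀

SH-∸-closed : ∀ m x → SH (suc m) (suc x) → SH (suc m) (nH (suc m) ∸ suc x)
SH-∸-closed m x Sx with y , Cy , x+y≡n ← Conn-complement (SH⇒Conn Sx) =
  Conn⇒SH (subst (Conn (suc m)) (sym n∸x≡y) Cy)
  where
  n∸x≡y : nH (suc m) ∸ suc x ≡ y
  n∸x≡y = begin
    nH (suc m) ∸ suc x    ≡⟨ cong (_∸ suc x) (+-comm (5 * suc m) 4) ⟩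
    4 + 5 * suc m ∸ suc x ≡⟨ cong (_∸ suc x) x+y≡n ⟨
    suc x + y ∸ suc x     ≡⟨ m+n∸m≡n (suc x) y ⟩
    y                     ∎
    where open ≡-Reasoning

SH-symmetric : ∀ m → SymmetricConn (nH (suc m)) (SH (suc m))
SH-symmetric m =
  (λ { zero _ S0 → ⊥-elim (¬SH0 S0) ; (suc x) _ Sx → SH-∸-closed m x Sx }) , ¬SH0
  where
  ¬SH0 : ¬ SH (suc m) 0
  ¬SH0 S0 = <-irrefl refl (Conn-pos (SH⇒Conn S0))

pairsFrom : ℕ → ℕ → List ℕ → List ℕ
pairsFrom i zero    tl = tl
pairsFrom i (suc c) tl = 1 + 5 * i ∷ 3 + 5 * i ∷ pairsFrom (suc i) c tl

lastTwo : ℕ → List ℕ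
lastTwo k = 2 + 5 * k ∷ 3 + 5 * k ∷ []

Conn-list : ℕ → List ℕ
Conn-list k = 1 ∷ 2 ∷ pairsFrom 1 (pred k) (lastTwo k)

pairsFrom-length : ∀ i c tl → length (pairsFrom i c tl) ≡ c + c + length tl
pairsFrom-length i zero    tl = refl
pairsFrom-length i (suc c) tl = cong suc (begin
  suc (length (pairsFrom (suc i) c tl)) ≡⟨ cong suc (pairsFrom-length (suc i) c tl) ⟩
  suc (c + c) + length tl               ≡⟨ cong (_+ length tl) (+-suc c c) ⟨
  c + suc c + length tl                 ∎)
  where open ≡-Reasoning

Conn-list-length : ∀ m → length (Conn-list (suc m)) ≡ 2 * suc m + 2
Conn-list-length m = trans (cong (2 +_) (pairsFrom-length 1 m _)) (eq m)
  where
  eq : ∀ m → 2 + (m + m + 2) ≡ 2 * suc m + 2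
  eq = solve-∀

pairsFrom-sorted : ∀ i c tl → (∀ {x} → x ≤ 5 * (c + i) → Linked _<_ (x ∷ tl)) →
                   ∀ {x} → x ≤ 5 * i → Linked _<_ (x ∷ pairsFrom i c tl)
pairsFrom-sorted i zero    tl tl-sorted x≤ = tl-sorted x≤
pairsFrom-sorted i (suc c) tl tl-sorted x≤ =
  s≤s x≤ ∷ s≤s (s≤s (n≤1+n (5 * i))) ∷
  pairsFrom-sorted (suc i) c tl tl-sorted′ 3+5i≤5[1+i]
  where
  tl-sorted′ : ∀ {x} → x ≤ 5 * (c + suc i) → Linked _<_ (x ∷ tl)
  tl-sorted′ {x} = tl-sorted ∘′ subst (λ z → x ≤ 5 * z) (+-suc c i)
  3+5i≤5[1+i] : 3 + 5 * i ≤ 5 * suc i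
  3+5i≤5[1+i] = ≤-trans (+-monoˡ-≤ (5 * i) {3} {5} (s≤s (s≤s (s≤s z≤n))))
                        (≤-reflexive (sym (*-suc 5 i)))

Conn-list-sorted : ∀ m → Linked _<_ (Conn-list (suc m))
Conn-list-sorted m = s≤s (s≤s z≤n) ∷ pairsFrom-sorted 1 m _ tail-sorted (s≤s (s≤s z≤n))
  where
  tail-sorted : ∀ {x} → x ≤ 5 * (m + 1) → Linked _<_ (x ∷ lastTwo (suc m))
  tail-sorted {x} x≤ =
    s≤s (≤-trans (subst (λ z → x ≤ 5 * z) (+-comm m 1) x≤) (n≤1+n _)) ∷ n<1+n _ ∷ [-]

Conn-list-unique : ∀ m → Unique (Conn-list (suc m))
Conn-list-unique m = AllPairs.map <⇒≢ (Linked⇒AllPairs <-trans (Conn-list-sorted m))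

∈-pairsFrom-tail : ∀ i c {tl x} → x ∈ tl → x ∈ pairsFrom i c tl
∈-pairsFrom-tail i zero    x∈ = x∈
∈-pairsFrom-tail i (suc c) x∈ = there (there (∈-pairsFrom-tail (suc i) c x∈))

∈-pairsFrom : ∀ r i t c tl → r ≡ 1 ⊎ r ≡ 3 → t < c → r + 5 * (i + t) ∈ pairsFrom i c tl
∈-pairsFrom _ i zero    (suc c) tl (inj₁ refl) _ = here (cong (λ z → 1 + 5 * z) (+-identityʳ i))
∈-pairsFrom _ i zero    (suc c) tl (inj₂ refl) _ = there (here (cong (λ z → 3 + 5 * z) (+-identityʳ i)))
∈-pairsFrom r i (suc t) (suc c) tl r∈ (s≤s t<c) =
  there (there (subst (λ z → r + 5 * z ∈ pairsFrom (suc i) c tl) (sym (+-suc i t))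
                      (∈-pairsFrom r (suc i) t c tl r∈ t<c)))

Conn⇒∈Conn-list : ∀ {m x} → Conn (suc m) x → x ∈ Conn-list (suc m)
Conn⇒∈Conn-list (one+5q zero _) = here refl
Conn⇒∈Conn-list {m} (one+5q (suc q) (s≤s q<m)) =
  there (there (∈-pairsFrom 1 1 q m (lastTwo (suc m)) (inj₁ refl) q<m))
Conn⇒∈Conn-list {m} (three+5q (suc q) _ q<1+m) with m≤n⇒m<n∨m≡n q<1+m
... | inj₁ (s≤s q<m) = there (there (∈-pairsFrom 3 1 q m (lastTwo (suc m)) (inj₂ refl) q<m))
... | inj₂ refl      = there (there (∈-pairsFrom-tail 1 m (there (here refl))))
Conn⇒∈Conn-list two = there (here refl)
Conn⇒∈Conn-list {m} two+5k = there (there (∈-pairsFrom-tail 1 m (here refl)))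

pairsFrom⇒Conn : ∀ {k} i c {tl} → 0 < i → i + c ≤ k → (∀ {x} → x ∈ tl → Conn k x) →
                 ∀ {x} → x ∈ pairsFrom i c tl → Conn k x
pairsFrom⇒Conn i zero    _   _   tl⊆ x∈ = tl⊆ x∈
pairsFrom⇒Conn {k} i (suc c) 0<i i+c≤k _ (here refl) =
  one+5q i (≤-trans (s≤s (m≤m+n i c)) (subst (_≤ k) (+-suc i c) i+c≤k))
pairsFrom⇒Conn i (suc c) 0<i i+c≤k _ (there (here refl)) =
  three+5q i 0<i (≤-trans (m≤m+n i (suc c)) i+c≤k)
pairsFrom⇒Conn {k} i (suc c) 0<i i+c≤k tl⊆ (there (there x∈)) =
  pairsFrom⇒Conn (suc i) c z<s (subst (_≤ k) (+-suc i c) i+c≤k) tl⊆ x∈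

∈Conn-list⇒Conn : ∀ {m x} → x ∈ Conn-list (suc m) → Conn (suc m) x
∈Conn-list⇒Conn (here refl) = one+5q 0 z<s
∈Conn-list⇒Conn (there (here refl)) = two
∈Conn-list⇒Conn {m} (there (there x∈)) = pairsFrom⇒Conn 1 m z<s ≤-refl tail⇒Conn x∈
  where
  tail⇒Conn : ∀ {x} → x ∈ lastTwo (suc m) → Conn (suc m) x
  tail⇒Conn (here refl) = two+5k
  tail⇒Conn (there (here refl)) = three+5q (suc m) z<s ≤-refl

data NonConn (k : ℕ) : ℕ → Set where
  five        : NonConn k 5
  five*[2+i]  : ∀ i t → k ≡ 2 + i + t → NonConn k (5 * (2 + i))
  one+5k      : NonConn k (1 + 5 * k)
  two+5[1+j]  : ∀ j t → k ≡ 2 + j + t → NonConn k (2 + 5 * suc j)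
  three       : NonConn k 3
  four+5j     : ∀ j t → k ≡ 2 + j + t → NonConn k (4 + 5 * j)
  four+5[k-1] : ∀ j → k ≡ suc j → NonConn k (4 + 5 * j)

private
  4+5q<4+5k⇒q<k : ∀ {q k} → 4 + 5 * q < 4 + 5 * k → q < k
  4+5q<4+5k⇒q<k {q} {k} lt = *-cancelˡ-< 5 q k (+-cancelˡ-< 4 (5 * q) (5 * k) lt)

NonConn-classify′ : ∀ {k} r q → r < 5 → 0 < r + 5 * q → r + 5 * q < 4 + 5 * k →
                    ¬ Conn k (r + 5 * q) → NonConn k (r + 5 * q)
NonConn-classify′ 0 0 _ () _ _
NonConn-classify′ 0 1 _ _ _ _ = five
NonConn-classify′ 0 (suc (suc i)) _ _ d<n _
  with t , eq ← m≤n⇒∃[o]m+o≡n (r+5q≤4+5k⇒q≤k 0 (<⇒≤ d<n)) = five*[2+i] i t (sym eq)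
NonConn-classify′ 1 q _ _ d<n d∉ with m≤n⇒m<n∨m≡n (r+5q≤4+5k⇒q≤k 1 (<⇒≤ d<n))
... | inj₁ q<k = ⊥-elim (d∉ (one+5q q q<k))
... | inj₂ refl = one+5k
NonConn-classify′ 2 zero _ _ _ d∉ = ⊥-elim (d∉ two)
NonConn-classify′ 2 (suc j) _ _ d<n d∉ with m≤n⇒m<n∨m≡n (r+5q≤4+5k⇒q≤k 2 (<⇒≤ d<n))
... | inj₁ 1+j<k with t , eq ← m≤n⇒∃[o]m+o≡n 1+j<k = two+5[1+j] j t (sym eq)
... | inj₂ refl = ⊥-elim (d∉ two+5k)
NonConn-classify′ 3 zero _ _ _ _ = three
NonConn-classify′ 3 (suc j) _ _ d<n d∉ =
  ⊥-elim (d∉ (three+5q (suc j) z<s (r+5q≤4+5k⇒q≤k 3 (<⇒≤ d<n))))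
NonConn-classify′ 4 j _ _ d<n _ with m≤n⇒m<n∨m≡n (4+5q<4+5k⇒q<k d<n)
... | inj₁ 1+j<k with t , eq ← m≤n⇒∃[o]m+o≡n 1+j<k = four+5j j t (sym eq)
... | inj₂ eq = four+5[k-1] j (sym eq)
NonConn-classify′ (suc (suc (suc (suc (suc _))))) _ (s≤s (s≤s (s≤s (s≤s (s≤s ()))))) _ _ _

nH-nonZero : ∀ k → NonZero (nH k)
nH-nonZero k = ≢-nonZero (λ eq → 1+n≢0 (trans (+-comm 4 (5 * k)) eq))

CommonEdge : ℕ → ℕ → Set
CommonEdge k = ℤ-mod.CommonNeighbourEdge (nH k) {{nH-nonZero k}} (Conn k)

private
  commonEdge-5 : ∀ {k} → 2 < k → CommonEdge k 5
  commonEdge-5 {k} 2<k = common-edge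
    (one+5q 2 2<k) (three+5q 2 z<s (<⇒≤ 2<k)) two (one+5q 1 1<k) (three+5q 1 z<s (<⇒≤ 1<k))
    (inj₁ refl) (inj₁ refl) (inj₁ refl)
    where
    open ℤ-mod (nH k) {{nH-nonZero k}} using (common-edge)
    1<k = <⇒≤ 2<k

  commonEdge-5[2+i] : ∀ i t → CommonEdge (2 + i + t) (5 * (2 + i))
  commonEdge-5[2+i] i t = common-edge
    two (three+5q (suc i) z<s (<⇒≤ 1+i<k)) (one+5q (suc i) 1+i<k)
    (one+5q (suc t) (s≤s (s≤s (m≤n+m t i)))) two+5k
    (inj₁ refl) (inj₂ (e₁ i t)) (inj₂ (e₂ i t))
    where
    open ℤ-mod (nH (2 + i + t)) {{nH-nonZero (2 + i + t)}} using (common-edge)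
    1+i<k : suc i < 2 + i + t
    1+i<k = m≤m+n (2 + i) t
    e₁ : ∀ i t → 5 * (2 + i) + (1 + 5 * suc t) ≡ 2 + (5 * (2 + i + t) + 4)
    e₁ = solve-∀
    e₂ : ∀ i t → 5 * (2 + i) + (2 + 5 * (2 + i + t)) ≡ 3 + 5 * suc i + (5 * (2 + i + t) + 4)
    e₂ = solve-∀

  commonEdge-1+5k : ∀ {k} → 0 < k → CommonEdge k (1 + 5 * k)
  commonEdge-1+5k {k} 0<k = common-edge
    two+5k (three+5q k 0<k ≤-refl) (one+5q 0 0<k) (one+5q 0 0<k) two
    (inj₁ (e₁ k)) (inj₁ (e₂ k)) (inj₁ (e₃ k))
    where
    open ℤ-mod (nH k) {{nH-nonZero k}} using (common-edge)
    e₁ : ∀ k → 2 + 5 * k + (1 + 5 * 0) ≡ 3 + 5 * k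
    e₁ = solve-∀
    e₂ : ∀ k → 1 + 5 * k + (1 + 5 * 0) ≡ 2 + 5 * k
    e₂ = solve-∀
    e₃ : ∀ k → 1 + 5 * k + 2 ≡ 3 + 5 * k
    e₃ = solve-∀

  commonEdge-2+5[1+j] : ∀ j t → CommonEdge (2 + j + t) (2 + 5 * suc j)
  commonEdge-2+5[1+j] j t = common-edge
    (one+5q 0 z<s) (three+5q (2 + j + t) z<s ≤-refl) two+5k
    (three+5q (suc t) z<s (<⇒≤ 1+t<k)) (one+5q (suc t) 1+t<k)
    (inj₁ refl) (inj₂ (e₁ j t)) (inj₁ (e₂ j t))
    where
    open ℤ-mod (nH (2 + j + t)) {{nH-nonZero (2 + j + t)}} using (common-edge)
    1+t<k : suc t < 2 + j + t
    1+t<k = s≤s (s≤s (m≤n+m t j))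
    e₁ : ∀ j t → 2 + 5 * suc j + (3 + 5 * suc t) ≡ 1 + (5 * (2 + j + t) + 4)
    e₁ = solve-∀
    e₂ : ∀ j t → 2 + 5 * suc j + (1 + 5 * suc t) ≡ 3 + 5 * (2 + j + t)
    e₂ = solve-∀

  commonEdge-3 : ∀ {k} → 0 < k → CommonEdge k 3
  commonEdge-3 {k} 0<k = common-edge
    (one+5q 0 0<k) two (one+5q 0 0<k) two+5k (three+5q k 0<k ≤-refl)
    (inj₁ refl) (inj₂ (e₁ k)) (inj₂ (e₂ k))
    where
    open ℤ-mod (nH k) {{nH-nonZero k}} using (common-edge)
    e₁ : ∀ k → 3 + (2 + 5 * k) ≡ 1 + 5 * 0 + (5 * k + 4)
    e₁ = solve-∀
    e₂ : ∀ k → 3 + (3 + 5 * k) ≡ 2 + (5 * k + 4)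
    e₂ = solve-∀

  commonEdge-4+5j : ∀ j t → CommonEdge (2 + j + t) (4 + 5 * j)
  commonEdge-4+5j j t = common-edge
    (one+5q (suc j) (m≤m+n (2 + j) t)) two+5k (one+5q (suc t) 1+t<k)
    two (three+5q (suc t) z<s (<⇒≤ 1+t<k))
    (inj₁ (e₁ j t)) (inj₁ (e₂ j)) (inj₁ (e₃ j t))
    where
    open ℤ-mod (nH (2 + j + t)) {{nH-nonZero (2 + j + t)}} using (common-edge)
    1+t<k : suc t < 2 + j + t
    1+t<k = s≤s (s≤s (m≤n+m t j))
    e₁ : ∀ j t → 1 + 5 * suc j + (1 + 5 * suc t) ≡ 2 + 5 * (2 + j + t)
    e₁ = solve-∀
    e₂ : ∀ j → 4 + 5 * j + 2 ≡ 1 + 5 * suc j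
    e₂ = solve-∀
    e₃ : ∀ j t → 4 + 5 * j + (3 + 5 * suc t) ≡ 2 + 5 * (2 + j + t)
    e₃ = solve-∀

  commonEdge-4+5[k-1] : ∀ j → 2 < suc j → CommonEdge (suc j) (4 + 5 * j)
  commonEdge-4+5[k-1] j 2<k = common-edge
    (one+5q 1 1<k) (three+5q 1 z<s (<⇒≤ 1<k)) two (one+5q 2 2<k) (three+5q 2 z<s (<⇒≤ 2<k))
    (inj₁ refl) (inj₂ (e₁ j)) (inj₂ (e₂ j))
    where
    open ℤ-mod (nH (suc j)) {{nH-nonZero (suc j)}} using (common-edge)
    1<k = <⇒≤ 2<k
    e₁ : ∀ j → 4 + 5 * j + (1 + 5 * 2) ≡ 1 + 5 * 1 + (5 * suc j + 4)
    e₁ = solve-∀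
    e₂ : ∀ j → 4 + 5 * j + (3 + 5 * 2) ≡ 3 + 5 * 1 + (5 * suc j + 4)
    e₂ = solve-∀

NonConn⇒CommonEdge : ∀ {k d} → 2 < k → NonConn k d → CommonEdge k d
NonConn⇒CommonEdge 2<k five                      = commonEdge-5 2<k
NonConn⇒CommonEdge _   (five*[2+i] i t refl)     = commonEdge-5[2+i] i t
NonConn⇒CommonEdge 2<k one+5k                    = commonEdge-1+5k (<-trans z<s 2<k)
NonConn⇒CommonEdge _   (two+5[1+j] j t refl)     = commonEdge-2+5[1+j] j t
NonConn⇒CommonEdge 2<k three                     = commonEdge-3 (<-trans z<s 2<k)
NonConn⇒CommonEdge _   (four+5j j t refl)        = commonEdge-4+5j j t
NonConn⇒CommonEdge 2<k (four+5[k-1] j refl)      = commonEdge-4+5[k-1] j 2<k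

NonConn-classify : ∀ {k d} → 0 < d → d < 4 + 5 * k → ¬ Conn k d → NonConn k d
NonConn-classify {k} {d} d>0 d<n d∉ =
  subst (NonConn k) (sym d≡) (NonConn-classify′ (d % 5) (d / 5) (m%n<n d 5)
    (subst (0 <_) d≡ d>0) (subst (_< 4 + 5 * k) d≡ d<n) (d∉ ∘ subst (Conn k) (sym d≡)))
  where d≡ = x≡r+5[x/5] d refl

SH-< : ∀ {m x} → SH (suc m) x → x < nH (suc m)
SH-< {m} {x} Sx = subst (x <_) (+-comm 4 (5 * suc m)) (Conn-< (SH⇒Conn Sx))

H-regular : ∀ m → Regular (2 * suc m + 2) (H (suc m))
H-regular m = subst (λ d → Regular d (H (suc m))) (Conn-list-length m)
  (Cay-regular (SH (suc m)) SH-< (Conn-list-unique m)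
    (mk⇔ (Conn⇒∈Conn-list ∘ SH⇒Conn) (Conn⇒SH ∘ ∈Conn-list⇒Conn)))
  where open ℤ-mod (nH (suc m)) {{nH-nonZero (suc m)}}

H-K4-free : ∀ m → ¬ HasK4 (H (suc m))
H-K4-free m K4 =
  Conn-noSumTriple (SumTriple-map SH⇒Conn (Cay-K4⇒SumTriple (SH (suc m)) (SH-symmetric m) K4))
  where open ℤ-mod (nH (suc m)) {{nH-nonZero (suc m)}}

H-K4-saturating : ∀ m → 2 < suc m →
                  ∀ u v → u ≢ v → ¬ H (suc m) u v → HasK4 (addEdge (H (suc m)) u v)
H-K4-saturating m 2<k u v u≢v ¬uv =
  addEdge-K4 (SH (suc m)) (SH-symmetric m) SH-< u v u≢v
    (CommonNeighbourEdge-map Conn⇒SH (NonConn⇒CommonEdge 2<k d∉Conn))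
  where
  open ℤ-mod (nH (suc m)) {{nH-nonZero (suc m)}}
  d = diffℤ (nH (suc m)) u v
  d<n : d < 4 + 5 * suc m
  d<n = subst (d <_) (+-comm (5 * suc m) 4) (diff-< u v)
  d∉Conn : NonConn (suc m) d
  d∉Conn = NonConn-classify (≢⇒diff>0 u≢v) d<n (¬uv ∘ Conn⇒SH)

proposition3p3 : (k : ℕ) → 3 ≤ k →
    SymmetricConn (nH k) (SH k) × Regular (2 * k + 2) (H k) × K4Saturated (H k)
proposition3p3 (suc m) 3≤k = SH-symmetric m , H-regular m , H-K4-free m , H-K4-saturating m 3≤k
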